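{- For every finite graph $G$, $2\Delta(G)\leq \chi^{c}_i(G)\leq 2\chi'(G)$, where $\Delta(G)$ is the maximum degree of $G$ and $\chi'(G)$ is the chromatic index of $G$.
   Context: An incidence of a graph $G$ is a pair $(v,e)$ where $v$ is a vertex and $e$ an edge incident with $v$. For a vertex $w$, let $I(w)$ be the set of all incidences $(u,e)$ such that $e$ is an edge incident with $w$ (so $I(w)$ contains both incidences of every edge at $w$). Two incidences conflict if there is a vertex $w$ with both of them in $I(w)$; equivalently, $(u,e)$ and $(v,f)$ conflict iff $u=v$, or $uv\in\{e,f\}$, or there is a vertex $w$ with $e=uw$ and $f=vw$. A conflict-free incidence $k$-coloring of $G$ is an assignment of colors from a set of $k$ colors to the incidences of $G$ such that any two conflicting incidences receive distinct colors. The conflict-free incidence chromatic number $\chi^{c}_i(G)$ is the least $k$ for which such a coloring exists. The chromatic index $\chi'(G)$ is the least $k$ such that the edges can be colored with $k$ colors with adjacent edges receiving distinct colors. -}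

module Defs where

open import Data.Nat using (ℕ; _≤_; _⊔_; _*_)
open import Data.Bool using (Bool; true; false)
open import Data.Fin using (Fin) renaming (_<_ to _<ᶠ_)
open import Data.List using (List; length; filter; map; foldr; allFin)
open import Data.Product using (Σ; _×_; _,_; proj₁; proj₂)
open import Data.Sum using (_⊎_)
open import Relation.Nullary using (¬_)
open import Relation.Binary.PropositionalEquality using (_≡_; _≢_)
open import Data.Bool.Properties using (T?)

record Graph : Set where
  field
    n      : ℕ
    adj    : Fin n → Fin n → Bool
    sym    : ∀ u v → adj u v ≡ adj v u
    irrefl : ∀ v → adj v v ≡ false

module _ (G : Graph) where
  open Graph G

  Edge : Set
  Edge = Σ (Fin n × Fin n) λ p → (proj₁ p <ᶠ proj₂ p) × (adj (proj₁ p) (proj₂ p) ≡ true)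

  ends : Edge → Fin n × Fin n
  ends e = proj₁ e

  IncidentWith : Fin n → Edge → Set
  IncidentWith v e = (v ≡ proj₁ (ends e)) ⊎ (v ≡ proj₂ (ends e))

  SameEdge : Edge → Edge → Set
  SameEdge e f = ends e ≡ ends f

  AdjacentEdges : Edge → Edge → Set
  AdjacentEdges e f = Σ (Fin n) λ w → IncidentWith w e × IncidentWith w f

  IsEdgeColoring : (k : ℕ) → (Edge → Fin k) → Set
  IsEdgeColoring k c = ∀ e f → ¬ SameEdge e f → AdjacentEdges e f → c e ≢ c f

  EdgeColorable : ℕ → Set
  EdgeColorable k = Σ (Edge → Fin k) (IsEdgeColoring k)

  IsChromaticIndex : ℕ → Set
  IsChromaticIndex k = EdgeColorable k × (∀ j → EdgeColorable j → k ≤ j)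

  Incidence : Set
  Incidence = Σ (Fin n) λ v → Σ Edge λ e → IncidentWith v e

  vtx : Incidence → Fin n
  vtx i = proj₁ i

  edg : Incidence → Edge
  edg i = proj₁ (proj₂ i)

  SameIncidence : Incidence → Incidence → Set
  SameIncidence a b = (vtx a ≡ vtx b) × SameEdge (edg a) (edg b)

  InI : Fin n → Incidence → Set
  InI w a = IncidentWith w (edg a)

  Conflict : Incidence → Incidence → Set
  Conflict a b = Σ (Fin n) λ w → InI w a × InI w b

  IsCFIColoring : (k : ℕ) → (Incidence → Fin k) → Set
  IsCFIColoring k c = ∀ a b → ¬ SameIncidence a b → Conflict a b → c a ≢ c b

  CFIColorable : ℕ → Set
  CFIColorable k = Σ (Incidence → Fin k) (IsCFIColoring k)

  IsCFIChromaticNumber : ℕ → Set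
  IsCFIChromaticNumber k = CFIColorable k × (∀ j → CFIColorable j → k ≤ j)

  degree : Fin n → ℕ
  degree v = length (filter (λ u → T? (adj v u)) (allFin n))

  maxDegree : ℕ
  maxDegree = foldr _⊔_ 0 (map degree (allFin n))

-- At a vertex v, the 2·deg(v) incidences of the edges at v all lie in I(v), so they pairwise
-- conflict and need distinct colors. Conversely, a proper edge coloring c yields the
-- incidence coloring (v , e) ↦ (c e , which end of e is v): conflicting incidences on
-- distinct edges lie on adjacent edges, and those on the same edge sit at different ends.
module Submission where

open import Defs
open import Data.Nat using (ℕ; _≤_; _*_; _⊔_; z≤n)
open import Data.Nat.Properties using (*-zeroʳ; *-distribˡ-⊔; ⊔-lub)
open import Data.Bool using (true)
open import Data.Bool.Properties using (T?; T-≡)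
open import Data.Fin using (Fin; zero; suc; combine; remQuot)
open import Data.Fin.Properties using (<-cmp; _≟_; combine-injective; combine-remQuot; injective⇒≤)
open import Data.List using (List; []; _∷_; filter; map; foldr; allFin; lookup)
open import Data.List.Membership.Propositional.Properties using (∈-lookup)
import Data.List.Relation.Unary.All as All
open import Data.List.Relation.Unary.All.Properties using (all-filter)
open import Data.List.Relation.Unary.AllPairs using (_∷_)
open import Data.List.Relation.Unary.Unique.Propositional using (Unique)
open import Data.List.Relation.Unary.Unique.Propositional.Properties using (allFin⁺; filter⁺)
open import Data.Product using (_×_; _,_; proj₁; proj₂; uncurry)
open import Data.Product.Properties using (≡-dec)
open import Data.Sum using (_⊎_; inj₁; inj₂)
open import Function using (_∘_; Equivalence)
open import Relation.Binary using (tri<; tri≈; tri>)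
open import Relation.Binary.PropositionalEquality
open import Relation.Nullary using (yes; no; contradiction)

lookup-injective : ∀ {A : Set} {xs : List A} → Unique xs →
  ∀ i j → lookup xs i ≡ lookup xs j → i ≡ j
lookup-injective (_ ∷ _) zero zero _ = refl
lookup-injective (x∉ ∷ _) zero (suc j) eq = contradiction eq (All.lookup x∉ (∈-lookup j))
lookup-injective (x∉ ∷ _) (suc i) zero eq = contradiction (sym eq) (All.lookup x∉ (∈-lookup i))
lookup-injective (_ ∷ u) (suc i) (suc j) eq = cong suc (lookup-injective u i j eq)

*-foldr-⊔-lub : ∀ {A : Set} m k (f : A → ℕ) → (∀ x → m * f x ≤ k) →
  ∀ xs → m * foldr _⊔_ 0 (map f xs) ≤ k
*-foldr-⊔-lub m k f bound [] = subst (_≤ k) (sym (*-zeroʳ m)) z≤n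
*-foldr-⊔-lub m k f bound (x ∷ xs) =
  subst (_≤ k) (sym (*-distribˡ-⊔ m (f x) _)) (⊔-lub (bound x) (*-foldr-⊔-lub m k f bound xs))

module _ (G : Graph) where
  open Graph G using (n; adj; irrefl)

  adj⇒≢ : ∀ {u v} → adj u v ≡ true → u ≢ v
  adj⇒≢ {u} uv refl with trans (sym uv) (irrefl u)
  ... | ()

  edgeBetween : ∀ u v → adj u v ≡ true → Edge G
  edgeBetween u v uv with <-cmp u v
  ... | tri< u<v _ _ = (u , v) , u<v , uv
  ... | tri≈ _ u≡v _ = contradiction u≡v (adj⇒≢ uv)
  ... | tri> _ _ v<u = (v , u) , v<u , trans (Graph.sym G v u) uv

  edgeBetween-incidentˡ : ∀ u v uv → IncidentWith G u (edgeBetween u v uv)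
  edgeBetween-incidentˡ u v uv with <-cmp u v
  ... | tri< _ _ _ = inj₁ refl
  ... | tri≈ _ u≡v _ = contradiction u≡v (adj⇒≢ uv)
  ... | tri> _ _ _ = inj₂ refl

  edgeBetween-incidentʳ : ∀ u v uv → IncidentWith G v (edgeBetween u v uv)
  edgeBetween-incidentʳ u v uv with <-cmp u v
  ... | tri< _ _ _ = inj₂ refl
  ... | tri≈ _ u≡v _ = contradiction u≡v (adj⇒≢ uv)
  ... | tri> _ _ _ = inj₁ refl

  incident-resp-SameEdge : ∀ {w} e f → SameEdge G e f → IncidentWith G w e → IncidentWith G w f
  incident-resp-SameEdge {w} _ _ = subst (λ p → (w ≡ proj₁ p) ⊎ (w ≡ proj₂ p))

  otherEnd-unique : ∀ {v u w} e → IncidentWith G v e → IncidentWith G u e → IncidentWith G w e →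
    v ≢ u → v ≢ w → u ≡ w
  otherEnd-unique _ (inj₁ v≡) (inj₁ u≡) _ v≢u _ = contradiction (trans v≡ (sym u≡)) v≢u
  otherEnd-unique _ (inj₁ v≡) _ (inj₁ w≡) _ v≢w = contradiction (trans v≡ (sym w≡)) v≢w
  otherEnd-unique _ (inj₁ _) (inj₂ u≡) (inj₂ w≡) _ _ = trans u≡ (sym w≡)
  otherEnd-unique _ (inj₂ v≡) (inj₂ u≡) _ v≢u _ = contradiction (trans v≡ (sym u≡)) v≢u
  otherEnd-unique _ (inj₂ v≡) _ (inj₂ w≡) _ v≢w = contradiction (trans v≡ (sym w≡)) v≢w
  otherEnd-unique _ (inj₂ _) (inj₁ u≡) (inj₁ w≡) _ _ = trans u≡ (sym w≡)

  IsConflictClique : ∀ {m} → (Fin m → Incidence G) → Set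
  IsConflictClique f = (∀ i j → SameIncidence G (f i) (f j) → i ≡ j) × (∀ i j → Conflict G (f i) (f j))

  conflictClique⇒≤colors : ∀ {k m} {c : Incidence G → Fin k} → IsCFIColoring G k c →
    (f : Fin m → Incidence G) → IsConflictClique f → m ≤ k
  conflictClique⇒≤colors {c = c} proper f (same⇒≡ , conflict) = injective⇒≤ {f = c ∘ f} injective
    where
    injective : ∀ {i j} → c (f i) ≡ c (f j) → i ≡ j
    injective {i} {j} eq with i ≟ j
    ... | yes i≡j = i≡j
    ... | no i≢j = contradiction eq (proper (f i) (f j) (i≢j ∘ same⇒≡ i j) (conflict i j))

  module Star (v : Fin n) where
    deg : ℕ
    deg = degree G v

    neighbours : List (Fin n)
    neighbours = filter (λ u → T? (adj v u)) (allFin n)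

    neighbour : Fin deg → Fin n
    neighbour = lookup neighbours

    adj-neighbour : ∀ i → adj v (neighbour i) ≡ true
    adj-neighbour i =
      Equivalence.to T-≡ (All.lookup (all-filter (λ u → T? (adj v u)) (allFin n)) (∈-lookup i))

    neighbour-injective : ∀ i j → neighbour i ≡ neighbour j → i ≡ j
    neighbour-injective = lookup-injective (filter⁺ (λ u → T? (adj v u)) (allFin⁺ n))

    edge : Fin deg → Edge G
    edge i = edgeBetween v (neighbour i) (adj-neighbour i)

    centre-incident : ∀ i → IncidentWith G v (edge i)
    centre-incident i = edgeBetween-incidentˡ v (neighbour i) (adj-neighbour i)

    neighbour-incident : ∀ i → IncidentWith G (neighbour i) (edge i)
    neighbour-incident i = edgeBetween-incidentʳ v (neighbour i) (adj-neighbour i)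

    end : Fin 2 → Fin deg → Fin n
    end zero i = v
    end (suc zero) i = neighbour i

    end-incident : ∀ b i → IncidentWith G (end b i) (edge i)
    end-incident zero i = centre-incident i
    end-incident (suc zero) i = neighbour-incident i

    end-injective : ∀ b b' i → end b i ≡ end b' i → b ≡ b'
    end-injective zero zero i _ = refl
    end-injective zero (suc zero) i eq = contradiction eq (adj⇒≢ (adj-neighbour i))
    end-injective (suc zero) zero i eq = contradiction (sym eq) (adj⇒≢ (adj-neighbour i))
    end-injective (suc zero) (suc zero) i _ = refl

    starIncidence : Fin 2 → Fin deg → Incidence G
    starIncidence b i = end b i , edge i , end-incident b i

    starIncidence-injective : ∀ p q →
      SameIncidence G (uncurry starIncidence p) (uncurry starIncidence q) → p ≡ q
    starIncidence-injective (b , i) (b' , i') (same-vertex , same-edge)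
      with neighbour-injective i i'
             (otherEnd-unique (edge i) (centre-incident i) (neighbour-incident i)
               (incident-resp-SameEdge (edge i') (edge i) (sym same-edge) (neighbour-incident i'))
               (adj⇒≢ (adj-neighbour i)) (adj⇒≢ (adj-neighbour i')))
    ... | refl = cong (_, i) (end-injective b b' i same-vertex)

    incidence : Fin (2 * deg) → Incidence G
    incidence z = uncurry starIncidence (remQuot {2} deg z)

    incidence-at-centre : ∀ z → InI G v (incidence z)
    incidence-at-centre z = centre-incident (proj₂ (remQuot {2} deg z))

    incidence-isConflictClique : IsConflictClique incidence
    incidence-isConflictClique = same⇒≡ , λ z z' → v , incidence-at-centre z , incidence-at-centre z'
      where
      same⇒≡ : ∀ z z' → SameIncidence G (incidence z) (incidence z') → z ≡ z'
      same⇒≡ z z' same = begin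
        z                                    ≡⟨ combine-remQuot {2} deg z ⟨
        uncurry combine (remQuot {2} deg z)  ≡⟨ cong (uncurry combine)
                                                  (starIncidence-injective (remQuot {2} deg z) (remQuot {2} deg z') same) ⟩
        uncurry combine (remQuot {2} deg z') ≡⟨ combine-remQuot {2} deg z' ⟩
        z'                                   ∎
        where open ≡-Reasoning

  2*maxDegree≤colors : ∀ {k} {c : Incidence G → Fin k} → IsCFIColoring G k c → 2 * maxDegree G ≤ k
  2*maxDegree≤colors {k} proper = *-foldr-⊔-lub 2 k (degree G) 2*degree≤colors (allFin n)
    where
    2*degree≤colors : ∀ v → 2 * degree G v ≤ k
    2*degree≤colors v = conflictClique⇒≤colors proper (Star.incidence v) (Star.incidence-isConflictClique v)

  side : ∀ {v} e → IncidentWith G v e → Fin 2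
  side _ (inj₁ _) = zero
  side _ (inj₂ _) = suc zero

  side-injective : ∀ {v w} e f (v∈e : IncidentWith G v e) (w∈f : IncidentWith G w f) →
    SameEdge G e f → side e v∈e ≡ side f w∈f → v ≡ w
  side-injective _ _ (inj₁ v≡) (inj₁ w≡) e≡f _ = trans v≡ (trans (cong proj₁ e≡f) (sym w≡))
  side-injective _ _ (inj₂ v≡) (inj₂ w≡) e≡f _ = trans v≡ (trans (cong proj₂ e≡f) (sym w≡))
  side-injective _ _ (inj₁ _) (inj₂ _) _ ()
  side-injective _ _ (inj₂ _) (inj₁ _) _ ()

  edgeColorable⇒cfiColorable : ∀ {k} → EdgeColorable G k → CFIColorable G (2 * k)
  edgeColorable⇒cfiColorable {k} (c , proper) = coloring , coloring-proper
    where
    coloring : Incidence G → Fin (2 * k)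
    coloring (_ , e , v∈e) = combine (side e v∈e) (c e)

    coloring-proper : IsCFIColoring G (2 * k) coloring
    coloring-proper (_ , e , v∈e) (_ , f , w∈f) a≢b e∼f eq
      with ≡-dec _≟_ _≟_ (ends G e) (ends G f) | combine-injective (side e v∈e) (c e) (side f w∈f) (c f) eq
    ... | yes e≡f | sides≡ , _ = a≢b (side-injective e f v∈e w∈f e≡f sides≡ , e≡f)
    ... | no e≢f | _ , colors≡ = proper e f e≢f e∼f colors≡

proposition2p1 : (G : Graph) (χci χ' : ℕ) →
    IsCFIChromaticNumber G χci → IsChromaticIndex G χ' →
    (2 * maxDegree G ≤ χci) × (χci ≤ 2 * χ')
proposition2p1 G χci χ' ((_ , proper) , χci-minimal) (edgeColoring , _) =
  2*maxDegree≤colors G proper , χci-minimal (2 * χ') (edgeColorable⇒cfiColorable G edgeColoring)
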